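{- Let $n\ge 3$ and $i\in\{2,\ldots,n-1\}$, and let $\bar S_i=\{n-i+1,n-i+2,\ldots,n-1\}$. Then \[\max\{d_\ell(\sigma,\rho):\sigma,\rho\in\mathcal{D}(\bar S_i;n),\ \sigma\ne\rho\}=\max\{i-1,\,n-i\}.\]
   Context: $S_n$ is the symmetric group on $[n]=\{1,\ldots,n\}$, with permutations in one-line notation $\sigma=\sigma_1\cdots\sigma_n$. The descent set of $\sigma$ is $\mathcal{D}(\sigma)=\{j\in[n-1]:\sigma_j>\sigma_{j+1}\}$, and for $S\subseteq[n-1]$, $\mathcal{D}(S;n)=\{\sigma\in S_n:\mathcal{D}(\sigma)=S\}$. The $\ell_\infty$-metric is $d_\ell(\sigma,\rho)=\max\{|\sigma_j-\rho_j|:1\le j\le n\}$. -}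

module Defs where

open import Data.Nat using (ℕ; suc; _<_; _≤_; _∸_; _+_; _⊔_; ∣_-_∣)
open import Data.Fin using (Fin; toℕ)
open import Data.Fin.Permutation using (Permutation′; _⟨$⟩ʳ_; _≈_)
open import Data.List using (foldr; map; allFin)
open import Data.Product using (_×_)
open import Relation.Binary.PropositionalEquality using (_≡_)
open import Function.Bundles using (_⇔_)

-- Permutations of [n] are represented as permutations of Fin n; positions and
-- values are shifted down by 1 (position p : Fin n is position toℕ p + 1,
-- value v is toℕ v + 1). Differences of values are unaffected by the shift.

val : {n : ℕ} → Permutation′ n → Fin n → ℕ
val σ p = toℕ (σ ⟨$⟩ʳ p)

-- (1-indexed) position j = toℕ a + 1 is a descent of σ, where b is the next position
-- The descent set of σ equals the set S (given as a predicate on 1-indexed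
-- positions j ∈ [n-1]).
HasDescentSet : (n : ℕ) → Permutation′ n → (ℕ → Set) → Set
HasDescentSet n σ S =
  (a b : Fin n) → toℕ b ≡ suc (toℕ a) → ((val σ b < val σ a) ⇔ S (suc (toℕ a)))

SBar : (n i : ℕ) → ℕ → Set
SBar n i j = suc (n ∸ i) ≤ j

dℓ : {n : ℕ} → Permutation′ n → Permutation′ n → ℕ
dℓ {n} σ ρ = foldr _⊔_ 0 (map (λ j → ∣ val σ j - val ρ j ∣) (allFin n))

{-# OPTIONS --safe #-}
module Submission where

-- Write n = a + b + 1 with a = n − i and b = i − 1, and index positions and values from 0.
-- A permutation with descent set S̄ᵢ rises strictly on positions 0, …, a and falls strictly
-- on a, …, a + b. Counting steps along the two runs traps the value at a rising position k
-- in [k, k + b] and at a falling position a + d in [b − d, b − d + a], so two such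
-- permutations differ by at most max(b, a) at every position. The bound is attained by the
-- permutation that starts 0, 1, …, a − 1 and the one whose rising run is b, b + 1, …, a + b:
-- they differ by b at the first position and by a at the last.

open import Defs
open import Data.Nat
  using (ℕ; zero; suc; _+_; _∸_; _⊔_; _≤_; _<_; z≤n; s≤s; s≤s⁻¹; ∣_-_∣; _≤?_; _<?_)
open import Data.Nat.Properties
open import Data.Nat.Tactic.RingSolver using (solve)
open import Data.Fin using (Fin; toℕ; fromℕ<; fromℕ)
open import Data.Fin.Patterns using (0F)
open import Data.Fin.Properties
  using (toℕ-fromℕ<; fromℕ<-toℕ; toℕ-fromℕ; toℕ<n; toℕ-injective)
open import Data.Fin.Permutation using (Permutation′; _≈_; permutation; _⟨$⟩ʳ_)
open import Data.List using ([]; _∷_)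
open import Data.List.Properties using (foldr-preservesᵇ; foldr-preservesᵒ)
import Data.List.Relation.Unary.All.Properties as All
open import Data.List.Membership.Propositional using (lose)
open import Data.List.Membership.Propositional.Properties using (∈-map⁺; ∈-allFin)
open import Data.Product using (_×_; _,_; ∃-syntax)
open import Data.Sum using (_⊎_; inj₂; [_,_]′)
open import Function using (_∘_)
open import Function.Bundles using (_⇔_; mk⇔; Equivalence; Injection)
open import Function.Properties.Inverse using (↔⇒↣)
open import Relation.Binary.PropositionalEquality
  using (_≡_; _≢_; refl; sym; trans; cong; subst; subst₂; module ≡-Reasoning)
open import Relation.Nullary using (¬_; yes; no; contradiction)

dℓ-lub : ∀ {n m} (σ ρ : Permutation′ n) → (∀ j → ∣ val σ j - val ρ j ∣ ≤ m) → dℓ σ ρ ≤ m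
dℓ-lub {m = m} σ ρ bound =
  foldr-preservesᵇ {P = _≤ m} ⊔-lub z≤n (All.map⁺ (All.tabulate⁺ bound))

∣val-val∣≤dℓ : ∀ {n} (σ ρ : Permutation′ n) j → ∣ val σ j - val ρ j ∣ ≤ dℓ σ ρ
∣val-val∣≤dℓ σ ρ j = foldr-preservesᵒ {P = ∣ val σ j - val ρ j ∣ ≤_} ≤⊔ 0 _
  (inj₂ (lose (∈-map⁺ _ (∈-allFin j)) ≤-refl))
  where
  ≤⊔ : ∀ {v} x y → v ≤ x ⊎ v ≤ y → v ≤ x ⊔ y
  ≤⊔ x y = [ m≤n⇒m≤n⊔o y , m≤n⇒m≤o⊔n x ]′

∣m-n∣≤w : ∀ {l w m n} → l ≤ m × m ≤ l + w → l ≤ n × n ≤ l + w → ∣ m - n ∣ ≤ w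
∣m-n∣≤w {l} {w} {m} {n} (l≤m , m≤l+w) (l≤n , n≤l+w) =
  [ (λ eq → ≤-trans (≤-reflexive eq) (∸≤w m≤l+w l≤n))
  , (λ eq → ≤-trans (≤-reflexive eq) (∸≤w n≤l+w l≤m)) ]′ (∣m-n∣≡[m∸n]∨[n∸m] m n)
  where
  ∸≤w : ∀ {x y} → x ≤ l + w → l ≤ y → x ∸ y ≤ w
  ∸≤w x≤l+w l≤y = ≤-trans (∸-mono x≤l+w l≤y) (≤-reflexive (m+n∸m≡n l w))

record Unimodal (a b : ℕ) (f : ℕ → ℕ) : Set where
  field
    ascending  : ∀ k → k < a → f k < f (suc k)
    descending : ∀ k → a ≤ k → k < a + b → f (suc k) < f k

ascending⇒+-≤ : ∀ {m} {f : ℕ → ℕ} → (∀ k → k < m → f k < f (suc k)) →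
                ∀ d k → d + k ≤ m → f k + d ≤ f (d + k)
ascending⇒+-≤ step zero    k _       = ≤-reflexive (+-identityʳ _)
ascending⇒+-≤ {f = f} step (suc d) k d+k<m = begin
  f k + suc d      ≡⟨ +-suc (f k) d ⟩
  suc (f k + d)    ≤⟨ s≤s (ascending⇒+-≤ step d k (<⇒≤ d+k<m)) ⟩
  suc (f (d + k))  ≤⟨ step (d + k) d+k<m ⟩
  f (suc d + k)    ∎
  where open ≤-Reasoning

descending⇒+-≤ : ∀ {l m} {f : ℕ → ℕ} → (∀ k → l ≤ k → k < m → f (suc k) < f k) →
                 ∀ d k → l ≤ k → d + k ≤ m → f (d + k) + d ≤ f k
descending⇒+-≤ step zero    k _   _       = ≤-reflexive (+-identityʳ _)
descending⇒+-≤ {l} {f = f} step (suc d) k l≤k d+k<m = begin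
  f (suc d + k) + suc d      ≡⟨ +-suc _ d ⟩
  suc (f (suc d + k)) + d    ≤⟨ +-monoˡ-≤ d (step (d + k) l≤d+k d+k<m) ⟩
  f (d + k) + d              ≤⟨ descending⇒+-≤ step d k l≤k (<⇒≤ d+k<m) ⟩
  f k                        ∎
  where
  open ≤-Reasoning
  l≤d+k : l ≤ d + k
  l≤d+k = ≤-trans l≤k (m≤n+m k d)

Bounded : ℕ → (ℕ → ℕ) → Set
Bounded m f = ∀ k → k ≤ m → f k ≤ m

module _ {a b} {f : ℕ → ℕ} (unimodal : Unimodal a b f) (bounded : Bounded (a + b) f) where
  open Unimodal unimodal

  ascending-window : ∀ c k → c + k ≡ a → k ≤ f k × f k ≤ k + b
  ascending-window c k refl = lower , +-cancelʳ-≤ c (f k) (k + b) upper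
    where
    open ≤-Reasoning
    k+0≤c+k : k + 0 ≤ c + k
    k+0≤c+k = subst (_≤ c + k) (sym (+-identityʳ k)) (m≤n+m k c)
    lower : k ≤ f k
    lower = begin
      k            ≤⟨ m≤n+m k (f 0) ⟩
      f 0 + k      ≤⟨ ascending⇒+-≤ ascending k 0 k+0≤c+k ⟩
      f (k + 0)    ≡⟨ cong f (+-identityʳ k) ⟩
      f k          ∎
    upper : f k + c ≤ k + b + c
    upper = begin
      f k + c      ≤⟨ ascending⇒+-≤ ascending c k ≤-refl ⟩
      f (c + k)    ≤⟨ bounded (c + k) (m≤m+n (c + k) b) ⟩
      c + k + b    ≡⟨ solve (c ∷ k ∷ b ∷ []) ⟩
      k + b + c    ∎

  descending-window : ∀ d e → d + e ≡ b → e ≤ f (d + a) × f (d + a) ≤ e + a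
  descending-window d e refl = lower , +-cancelʳ-≤ d (f (d + a)) (e + a) upper
    where
    open ≤-Reasoning
    e+d+a≤a+d+e : e + (d + a) ≤ a + (d + e)
    e+d+a≤a+d+e = ≤-reflexive (solve (a ∷ d ∷ e ∷ []))
    d+a≤a+d+e : d + a ≤ a + (d + e)
    d+a≤a+d+e = ≤-trans (≤-reflexive (+-comm d a)) (+-monoʳ-≤ a (m≤m+n d e))
    lower : e ≤ f (d + a)
    lower = begin
      e                      ≤⟨ m≤n+m e _ ⟩
      f (e + (d + a)) + e    ≤⟨ descending⇒+-≤ descending e (d + a) (m≤n+m a d) e+d+a≤a+d+e ⟩
      f (d + a)              ∎
    upper : f (d + a) + d ≤ e + a + d
    upper = begin
      f (d + a) + d  ≤⟨ descending⇒+-≤ descending d a ≤-refl d+a≤a+d+e ⟩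
      f a            ≤⟨ bounded a (m≤m+n a (d + e)) ⟩
      a + (d + e)    ≡⟨ solve (a ∷ d ∷ e ∷ []) ⟩
      e + a + d      ∎

unimodal-∣-∣≤⊔ : ∀ {a b} {f g : ℕ → ℕ} →
                 Unimodal a b f → Bounded (a + b) f → Unimodal a b g → Bounded (a + b) g →
                 ∀ k → k ≤ a + b → ∣ f k - g k ∣ ≤ b ⊔ a
unimodal-∣-∣≤⊔ {a} {b} {f} {g} uf bf ug bg k k≤a+b with k ≤? a
... | yes k≤a = ≤-trans
  (∣m-n∣≤w (ascending-window uf bf _ k c+k≡a) (ascending-window ug bg _ k c+k≡a))
  (m≤m⊔n b a)
  where
  c+k≡a : a ∸ k + k ≡ a
  c+k≡a = m∸n+n≡m k≤a
... | no k≰a = subst (λ j → ∣ f j - g j ∣ ≤ b ⊔ a) (m∸n+n≡m a≤k) (≤-trans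
  (∣m-n∣≤w (descending-window uf bf (k ∸ a) _ d+e≡b) (descending-window ug bg (k ∸ a) _ d+e≡b))
  (m≤n⊔m b a))
  where
  a≤k : a ≤ k
  a≤k = ≰⇒≥ k≰a
  d+e≡b : k ∸ a + (b ∸ (k ∸ a)) ≡ b
  d+e≡b = m+[n∸m]≡n (≤-trans (∸-monoˡ-≤ a k≤a+b) (≤-reflexive (m+n∸m≡n a b)))

HasDescentSetℕ : ℕ → (ℕ → ℕ) → (ℕ → Set) → Set
HasDescentSetℕ n f S = ∀ k → suc k < n → (f (suc k) < f k ⇔ S (suc k))

unimodal⇒hasDescentSetℕ : ∀ {a b} {f : ℕ → ℕ} →
                          Unimodal a b f → HasDescentSetℕ (suc (a + b)) f (suc a ≤_)
unimodal⇒hasDescentSetℕ u k (s≤s k<a+b) = mk⇔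
  (λ desc → s≤s (≮⇒≥ (λ k<a → <-asym desc (ascending k k<a))))
  (λ { (s≤s a≤k) → descending k a≤k k<a+b })
  where open Unimodal u

hasDescentSetℕ⇒unimodal : ∀ {a b} {f : ℕ → ℕ} → HasDescentSetℕ (suc (a + b)) f (suc a ≤_) →
                          (∀ k → k < a + b → f k ≢ f (suc k)) → Unimodal a b f
hasDescentSetℕ⇒unimodal {a} {b} {f} D distinct = record
  { ascending  = λ k k<a →
      let k<a+b = ≤-trans k<a (m≤m+n a b)
          no-descent = λ desc → <⇒≱ k<a (s≤s⁻¹ (Equivalence.to (D k (s≤s k<a+b)) desc))
      in ≤∧≢⇒< (≮⇒≥ no-descent) (distinct k k<a+b)
  ; descending = λ k a≤k k<a+b → Equivalence.from (D k (s≤s k<a+b)) (s≤s a≤k)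
  }

hasDescentSet⇔ℕ : ∀ {n} S (σ : Permutation′ n) {f : ℕ → ℕ} → (∀ p → val σ p ≡ f (toℕ p)) →
                  HasDescentSet n σ S ⇔ HasDescentSetℕ n f S
hasDescentSet⇔ℕ {n} S σ {f} σ≗f = mk⇔ to from
  where
  val≡ : ∀ p {k} → toℕ p ≡ k → val σ p ≡ f k
  val≡ p refl = σ≗f p

  subst-<⇔ : ∀ {x x′ y y′} {P P′ : Set} →
             x ≡ x′ → y ≡ y′ → P ≡ P′ → (x < y ⇔ P) → (x′ < y′ ⇔ P′)
  subst-<⇔ refl refl refl e = e

  to : HasDescentSet n σ S → HasDescentSetℕ n f S
  to D k 1+k<n =
    subst-<⇔ (val≡ q (toℕ-fromℕ< 1+k<n)) (val≡ p p≡k) (cong (S ∘ suc) p≡k)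
             (D p q (trans (toℕ-fromℕ< 1+k<n) (cong suc (sym p≡k))))
    where
    k<n : k < n
    k<n = <-trans (n<1+n k) 1+k<n
    p q : Fin n
    p = fromℕ< k<n
    q = fromℕ< 1+k<n
    p≡k : toℕ p ≡ k
    p≡k = toℕ-fromℕ< k<n

  from : HasDescentSetℕ n f S → HasDescentSet n σ S
  from D p q q≡1+p = subst-<⇔ (sym (val≡ q q≡1+p)) (sym (σ≗f p)) refl
                              (D (toℕ p) (subst (_< n) q≡1+p (toℕ<n q)))

valℕ : ∀ {n} → Permutation′ n → ℕ → ℕ
valℕ {n} σ k with k <? n
... | yes k<n = val σ (fromℕ< k<n)
... | no  _   = 0

valℕ-toℕ : ∀ {n} (σ : Permutation′ n) p → valℕ σ (toℕ p) ≡ val σ p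
valℕ-toℕ {n} σ p with toℕ p <? n
... | yes p<n = cong (val σ) (fromℕ<-toℕ p p<n)
... | no  p≮n = contradiction (toℕ<n p) p≮n

valℕ-bounded : ∀ {m} (σ : Permutation′ (suc m)) → Bounded m (valℕ σ)
valℕ-bounded {m} σ k _ with k <? suc m
... | yes k<n = s≤s⁻¹ (toℕ<n (σ ⟨$⟩ʳ fromℕ< k<n))
... | no  _   = z≤n

valℕ-injective : ∀ {n} (σ : Permutation′ n) {k l} →
                 k < n → l < n → valℕ σ k ≡ valℕ σ l → k ≡ l
valℕ-injective σ {k} {l} k<n l<n eq = begin
  k                  ≡⟨ toℕ-fromℕ< k<n ⟨
  toℕ (fromℕ< k<n)   ≡⟨ cong toℕ (Injection.injective (↔⇒↣ σ) (toℕ-injective val-eq)) ⟩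
  toℕ (fromℕ< l<n)   ≡⟨ toℕ-fromℕ< l<n ⟩
  l                  ∎
  where
  open ≡-Reasoning
  val-eq : val σ (fromℕ< k<n) ≡ val σ (fromℕ< l<n)
  val-eq = begin
    val σ (fromℕ< k<n)         ≡⟨ valℕ-toℕ σ _ ⟨
    valℕ σ (toℕ (fromℕ< k<n))  ≡⟨ cong (valℕ σ) (toℕ-fromℕ< k<n) ⟩
    valℕ σ k                   ≡⟨ eq ⟩
    valℕ σ l                   ≡⟨ cong (valℕ σ) (toℕ-fromℕ< l<n) ⟨
    valℕ σ (toℕ (fromℕ< l<n))  ≡⟨ valℕ-toℕ σ _ ⟩
    val σ (fromℕ< l<n)         ∎

hasDescentSet⇒unimodal : ∀ {a b} {σ : Permutation′ (suc (a + b))} →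
                         HasDescentSet (suc (a + b)) σ (suc a ≤_) → Unimodal a b (valℕ σ)
hasDescentSet⇒unimodal {a} {σ = σ} D = hasDescentSetℕ⇒unimodal
  (Equivalence.to (hasDescentSet⇔ℕ (suc a ≤_) σ (sym ∘ valℕ-toℕ σ)) D)
  (λ k k<a+b eq → 1+n≢n (sym (valℕ-injective σ (m<n⇒m<1+n k<a+b) (s≤s k<a+b) eq)))

dℓ≤⊔ : ∀ {a b} (σ ρ : Permutation′ (suc (a + b))) →
       HasDescentSet (suc (a + b)) σ (suc a ≤_) → HasDescentSet (suc (a + b)) ρ (suc a ≤_) →
       dℓ σ ρ ≤ b ⊔ a
dℓ≤⊔ {a} {b} σ ρ Dσ Dρ = dℓ-lub σ ρ λ j →
  subst₂ (λ x y → ∣ x - y ∣ ≤ b ⊔ a) (valℕ-toℕ σ j) (valℕ-toℕ ρ j)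
    (unimodal-∣-∣≤⊔ (hasDescentSet⇒unimodal Dσ) (valℕ-bounded σ)
                    (hasDescentSet⇒unimodal Dρ) (valℕ-bounded ρ) (toℕ j) (s≤s⁻¹ (toℕ<n j)))

record BijectionBelow (n : ℕ) : Set where
  field
    to from : ℕ → ℕ
    to-<    : ∀ k → k < n → to k < n
    from-<  : ∀ k → k < n → from k < n
    to-from : ∀ k → k < n → to (from k) ≡ k
    from-to : ∀ k → k < n → from (to k) ≡ k

  toPermutation : Permutation′ n
  toPermutation = permutation (onFin to to-<) (onFin from from-<)
    (onFin-inverse to-< from-< to-from) (onFin-inverse from-< to-< from-to)
    where
    onFin : (h : ℕ → ℕ) → (∀ k → k < n → h k < n) → Fin n → Fin n
    onFin h h-< p = fromℕ< (h-< (toℕ p) (toℕ<n p))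

    onFin-inverse : ∀ {h h′} h-< h′-< → (∀ k → k < n → h (h′ k) ≡ k) →
                    ∀ p → onFin h h-< (onFin h′ h′-< p) ≡ p
    onFin-inverse {h} _ _ hh′ p = toℕ-injective
      (trans (toℕ-fromℕ< _) (trans (cong h (toℕ-fromℕ< _)) (hh′ (toℕ p) (toℕ<n p))))

  val-toPermutation : ∀ p → val toPermutation p ≡ to (toℕ p)
  val-toPermutation p = toℕ-fromℕ< _

unimodal⇒hasDescentSet : ∀ {a b} (π : BijectionBelow (suc (a + b))) →
                         Unimodal a b (BijectionBelow.to π) →
                         HasDescentSet (suc (a + b)) (BijectionBelow.toPermutation π) (suc a ≤_)
unimodal⇒hasDescentSet {a} π u = Equivalence.from
  (hasDescentSet⇔ℕ (suc a ≤_) toPermutation val-toPermutation) (unimodal⇒hasDescentSetℕ u)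
  where open BijectionBelow π

module Piecewise (a : ℕ) (f g : ℕ → ℕ) where
  piecewise : ℕ → ℕ
  piecewise k with k <? a
  ... | yes _ = f k
  ... | no  _ = g k

  below : ∀ {k} → k < a → piecewise k ≡ f k
  below {k} k<a with k <? a
  ... | yes _   = refl
  ... | no  k≮a = contradiction k<a k≮a

  above : ∀ {k} → a ≤ k → piecewise k ≡ g k
  above {k} a≤k with k <? a
  ... | yes k<a = contradiction a≤k (<⇒≱ k<a)
  ... | no  _   = refl

  cases : (P : ℕ → Set) → ∀ k → (k < a → P (f k)) → (a ≤ k → P (g k)) → P (piecewise k)
  cases P k Pf Pg with k <? a
  ... | yes k<a = Pf k<a
  ... | no  k≮a = Pg (≮⇒≥ k≮a)

-- lowFirst  = 0, 1, …, a − 1, a + b, a + b − 1, …, a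
-- highFirst = b, b + 1, …, a + b, b − 1, …, 0
module Extremal (a b : ℕ) where
  open ≤-Reasoning

  2a+b : ℕ
  2a+b = a + (a + b)

  module Low = Piecewise a (λ k → k) (2a+b ∸_)

  lowFirst : ℕ → ℕ
  lowFirst = Low.piecewise

  lowFirst-< : ∀ k → k < suc (a + b) → lowFirst k < suc (a + b)
  lowFirst-< k k<n = Low.cases (_< suc (a + b)) k (λ _ → k<n) λ a≤k → s≤s (begin
    2a+b ∸ k  ≤⟨ ∸-monoʳ-≤ 2a+b a≤k ⟩
    2a+b ∸ a  ≡⟨ m+n∸m≡n a (a + b) ⟩
    a + b     ∎)

  lowFirst-involutive : ∀ k → k < suc (a + b) → lowFirst (lowFirst k) ≡ k
  lowFirst-involutive k (s≤s k≤a+b) = Low.cases (λ v → lowFirst v ≡ k) k Low.below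
    λ _ → trans (Low.above a≤2a+b∸k) (m∸[m∸n]≡n (m≤n⇒m≤o+n a k≤a+b))
    where
    a≤2a+b∸k : a ≤ 2a+b ∸ k
    a≤2a+b∸k = begin
      a               ≡⟨ m+n∸n≡m a (a + b) ⟨
      2a+b ∸ (a + b)  ≤⟨ ∸-monoʳ-≤ 2a+b k≤a+b ⟩
      2a+b ∸ k        ∎

  lowFirst-unimodal : Unimodal a b lowFirst
  lowFirst-unimodal = record
    { ascending  = λ k k<a → subst (_< lowFirst (suc k)) (sym (Low.below k<a))
        (Low.cases (k <_) (suc k) (λ _ → n<1+n k) λ _ → begin-strict
          k             <⟨ k<a ⟩
          a             ≤⟨ m≤m+n a b ⟩
          a + b         ≡⟨ m+n∸m≡n a (a + b) ⟨
          2a+b ∸ a      ≤⟨ ∸-monoʳ-≤ 2a+b k<a ⟩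
          2a+b ∸ suc k  ∎)
    ; descending = λ k a≤k k<a+b →
        subst₂ _<_ (sym (Low.above (m≤n⇒m≤1+n a≤k))) (sym (Low.above a≤k))
          (∸-monoʳ-< (n<1+n k) (m≤n⇒m≤o+n a k<a+b))
    }

  lowFirst-first : 0 < a → lowFirst 0 ≡ 0
  lowFirst-first = Low.below

  lowFirst-last : lowFirst (a + b) ≡ a
  lowFirst-last = trans (Low.above (m≤m+n a b)) (m+n∸n≡m a (a + b))

  lowFirst-bijection : BijectionBelow (suc (a + b))
  lowFirst-bijection = record
    { to = lowFirst ; from = lowFirst ; to-< = lowFirst-< ; from-< = lowFirst-<
    ; to-from = lowFirst-involutive ; from-to = lowFirst-involutive }

  module High    = Piecewise (suc a) (_+ b) ((a + b) ∸_)
  module HighInv = Piecewise b ((a + b) ∸_) (_∸ b)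

  highFirst highFirst⁻¹ : ℕ → ℕ
  highFirst   = High.piecewise
  highFirst⁻¹ = HighInv.piecewise

  highFirst-< : ∀ k → k < suc (a + b) → highFirst k < suc (a + b)
  highFirst-< k _ = High.cases (_< suc (a + b)) k
    (λ k<1+a → s≤s (+-monoˡ-≤ b (s≤s⁻¹ k<1+a)))
    (λ _ → s≤s (m∸n≤m (a + b) k))

  highFirst⁻¹-< : ∀ v → v < suc (a + b) → highFirst⁻¹ v < suc (a + b)
  highFirst⁻¹-< v (s≤s v≤a+b) = HighInv.cases (_< suc (a + b)) v
    (λ _ → s≤s (m∸n≤m (a + b) v))
    (λ _ → s≤s (≤-trans (m∸n≤m v b) v≤a+b))

  highFirst⁻¹-highFirst : ∀ k → k < suc (a + b) → highFirst⁻¹ (highFirst k) ≡ k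
  highFirst⁻¹-highFirst k (s≤s k≤a+b) = High.cases (λ v → highFirst⁻¹ v ≡ k) k
    (λ _ → trans (HighInv.above (m≤n+m b k)) (m+n∸n≡m k b))
    (λ a<k → trans (HighInv.below (begin-strict
        (a + b) ∸ k   <⟨ ∸-monoʳ-< a<k k≤a+b ⟩
        (a + b) ∸ a   ≡⟨ m+n∸m≡n a b ⟩
        b             ∎))
      (m∸[m∸n]≡n k≤a+b))

  highFirst-highFirst⁻¹ : ∀ v → v < suc (a + b) → highFirst (highFirst⁻¹ v) ≡ v
  highFirst-highFirst⁻¹ v (s≤s v≤a+b) = HighInv.cases (λ k → highFirst k ≡ v) v
    (λ v<b → trans (High.above (begin-strict
        a             ≡⟨ m+n∸n≡m a b ⟨
        (a + b) ∸ b   <⟨ ∸-monoʳ-< v<b (m≤n+m b a) ⟩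
        (a + b) ∸ v   ∎))
      (m∸[m∸n]≡n v≤a+b))
    (λ b≤v → trans (High.below (s≤s (begin
        v ∸ b         ≤⟨ ∸-monoˡ-≤ b v≤a+b ⟩
        (a + b) ∸ b   ≡⟨ m+n∸n≡m a b ⟩
        a             ∎)))
      (m∸n+n≡m b≤v))

  highFirst-unimodal : Unimodal a b highFirst
  highFirst-unimodal = record
    { ascending  = λ k k<a →
        subst₂ _<_ (sym (High.below (m<n⇒m<1+n k<a))) (sym (High.below (s≤s k<a))) ≤-refl
    ; descending = λ k a≤k k<a+b → subst (_< highFirst k) (sym (High.above (s≤s a≤k)))
        (High.cases ((a + b) ∸ suc k <_) k
          (λ _ → begin-strict
            (a + b) ∸ suc k   <⟨ ∸-monoʳ-< (n<1+n k) k<a+b ⟩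
            (a + b) ∸ k       ≤⟨ m∸n≤m (a + b) k ⟩
            a + b             ≤⟨ +-monoˡ-≤ b a≤k ⟩
            k + b             ∎)
          (λ _ → ∸-monoʳ-< (n<1+n k) k<a+b))
    }

  highFirst-first : highFirst 0 ≡ b
  highFirst-first = High.below (s≤s z≤n)

  highFirst-last : 0 < b → highFirst (a + b) ≡ 0
  highFirst-last 0<b = trans (High.above (m<m+n a 0<b)) (n∸n≡0 (a + b))

  highFirst-bijection : BijectionBelow (suc (a + b))
  highFirst-bijection = record
    { to = highFirst ; from = highFirst⁻¹ ; to-< = highFirst-< ; from-< = highFirst⁻¹-<
    ; to-from = highFirst-highFirst⁻¹ ; from-to = highFirst⁻¹-highFirst }

  σ ρ : Permutation′ (suc (a + b))
  σ = BijectionBelow.toPermutation lowFirst-bijection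
  ρ = BijectionBelow.toPermutation highFirst-bijection

  σ-descents : HasDescentSet (suc (a + b)) σ (suc a ≤_)
  σ-descents = unimodal⇒hasDescentSet lowFirst-bijection lowFirst-unimodal

  ρ-descents : HasDescentSet (suc (a + b)) ρ (suc a ≤_)
  ρ-descents = unimodal⇒hasDescentSet highFirst-bijection highFirst-unimodal

  σ-val : ∀ p → val σ p ≡ lowFirst (toℕ p)
  σ-val = BijectionBelow.val-toPermutation lowFirst-bijection

  ρ-val : ∀ p → val ρ p ≡ highFirst (toℕ p)
  ρ-val = BijectionBelow.val-toPermutation highFirst-bijection

  last : Fin (suc (a + b))
  last = fromℕ (a + b)

  module _ (0<a : 0 < a) (0<b : 0 < b) where
    σ-first : val σ 0F ≡ 0
    σ-first = trans (σ-val 0F) (lowFirst-first 0<a)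

    ρ-first : val ρ 0F ≡ b
    ρ-first = trans (ρ-val 0F) highFirst-first

    σ-last : val σ last ≡ a
    σ-last = trans (σ-val last) (trans (cong lowFirst (toℕ-fromℕ (a + b))) lowFirst-last)

    ρ-last : val ρ last ≡ 0
    ρ-last = trans (ρ-val last)
      (trans (cong highFirst (toℕ-fromℕ (a + b))) (highFirst-last 0<b))

    σ≉ρ : ¬ (σ ≈ ρ)
    σ≉ρ σ≈ρ = <⇒≢ 0<b (trans (sym σ-first) (trans (cong toℕ (σ≈ρ 0F)) ρ-first))

    b⊔a≤dℓ : b ⊔ a ≤ dℓ σ ρ
    b⊔a≤dℓ = ⊔-lub
      (subst₂ ∣-∣≤dℓ σ-first ρ-first (∣val-val∣≤dℓ σ ρ 0F))
      (subst (_≤ dℓ σ ρ) (∣-∣-identityʳ a)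
        (subst₂ ∣-∣≤dℓ σ-last ρ-last (∣val-val∣≤dℓ σ ρ last)))
      where
      ∣-∣≤dℓ : ℕ → ℕ → Set
      ∣-∣≤dℓ x y = ∣ x - y ∣ ≤ dℓ σ ρ

MaxDistance : (n : ℕ) → (ℕ → Set) → ℕ → Set
MaxDistance n S m =
  (∃[ σ ] ∃[ ρ ] (HasDescentSet n σ S × HasDescentSet n ρ S × ¬ (σ ≈ ρ) × dℓ σ ρ ≡ m))
  × ((σ ρ : Permutation′ n) → HasDescentSet n σ S → HasDescentSet n ρ S →
     ¬ (σ ≈ ρ) → dℓ σ ρ ≤ m)

maxDistance-peak : ∀ a b → 0 < a → 0 < b → MaxDistance (suc (a + b)) (suc a ≤_) (b ⊔ a)
maxDistance-peak a b 0<a 0<b =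
  (σ , ρ , σ-descents , ρ-descents , σ≉ρ 0<a 0<b ,
   ≤-antisym (dℓ≤⊔ σ ρ σ-descents ρ-descents) (b⊔a≤dℓ 0<a 0<b))
  , λ σ′ ρ′ Dσ′ Dρ′ _ → dℓ≤⊔ σ′ ρ′ Dσ′ Dρ′
  where open Extremal a b

corollary5p6 : (n i : ℕ) → 3 ≤ n → 2 ≤ i → i ≤ n ∸ 1 →
    (∃[ σ ] ∃[ ρ ] (HasDescentSet n σ (SBar n i) × HasDescentSet n ρ (SBar n i)
        × ¬ (σ ≈ ρ) × dℓ σ ρ ≡ (i ∸ 1) ⊔ (n ∸ i)))
    × ((σ ρ : Permutation′ n) → HasDescentSet n σ (SBar n i) → HasDescentSet n ρ (SBar n i)
        → ¬ (σ ≈ ρ) → dℓ σ ρ ≤ (i ∸ 1) ⊔ (n ∸ i))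
-- 3 ≤ n only serves to make n a successor; for n = 1 + m and i = 1 + b the peak is at
-- a = m ∸ b, and SBar n i is then definitionally (suc a ≤_).
corollary5p6 (suc m) (suc b) (s≤s _) (s≤s 0<b) b<m =
  subst (λ n → MaxDistance n (suc (m ∸ b) ≤_) (b ⊔ (m ∸ b)))
        (cong suc (m∸n+n≡m (<⇒≤ b<m)))
        (maxDistance-peak (m ∸ b) b (m<n⇒0<n∸m b<m) 0<b)
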